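{- Every web in $\mathfrak M_n$ has at least three pairs of neighbors, where two boundary vertices that are consecutive in the cyclic order around the boundary circle are called neighbors if they are adjacent to a common internal vertex.
   Context: An $A_2$ web is a planar directed graph without multiple edges embedded in a disk, bipartite with every edge oriented from a "negative" vertex to a "positive" vertex, whose boundary vertices (on the boundary circle) have degree 1 and whose internal vertices have degree 3; it is irreducible if every internal face has at least 6 sides. $\mathfrak M_n$ ($n\ge1$) denotes the set of irreducible $A_2$ webs with $3n$ boundary vertices, all negative. -}

module Defs where

open import Data.Nat using (ℕ; zero; suc; _+_; _*_; _≤_; _<?_)
import Data.Nat.Properties
import Data.Fin
open import Data.Fin using (Fin; zero; suc; toℕ; fromℕ<)
open import Data.Fin.Properties using () renaming (_≟_ to _≟F_)
open import Data.Bool using (Bool; true; false; _∧_; _∨_; not; if_then_else_)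
open import Data.List using (List; []; _∷_; _++_; map; concatMap; length; filterᵇ; allFin)
open import Data.Bool.ListAction using (any; all)
open import Data.Sum using (_⊎_; inj₁; inj₂)
open import Relation.Nullary using (does; yes; no)
open import Relation.Binary.PropositionalEquality using (_≡_; _≢_)

next : ∀ {m} → Fin m → Fin m
next {suc m} i with suc (toℕ i) <? suc m
... | yes p = fromℕ< p
... | no _  = zero

prev : ∀ {m} → Fin m → Fin m
prev {suc m} zero    = fromℕ< {m} (Data.Nat.Properties.n<1+n m)
prev {suc m} (suc i) = Data.Fin.inject₁ i

-- Half-edges (darts) of a web with b boundary vertices and k internal
-- vertices.  Boundary vertex i carries exactly one dart  bd i  (degree 1);
-- internal vertex v carries exactly three darts  int v 0, int v 1, int v 2
-- (degree 3), listed in counterclockwise cyclic order around v.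

data WDart (b k : ℕ) : Set where
  bd  : Fin b → WDart b k
  int : Fin k → Fin 3 → WDart b k

vertW : ∀ {b k} → WDart b k → Fin b ⊎ Fin k
vertW (bd i)    = inj₁ i
vertW (int v j) = inj₂ v

-- sign of the vertex of a dart (true = positive); boundary vertices are
-- all negative (webs in 𝔐ₙ)
sign : ∀ {b k} → (Fin k → Bool) → WDart b k → Bool
sign pos (bd i)    = false
sign pos (int v j) = pos v

-- The disk embedding is encoded by capping the disk off to a sphere:
-- add one extra vertex ∞ outside the disk and an edge (cap i — inf i)
-- from boundary vertex i to ∞.

data Dart (b k : ℕ) : Set where
  web : WDart b k → Dart b k
  cap : Fin b → Dart b k
  inf : Fin b → Dart b k

isWeb : ∀ {b k} → Dart b k → Bool
isWeb (web _) = true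
isWeb (cap _) = false
isWeb (inf _) = false

eqF : ∀ {m} → Fin m → Fin m → Bool
eqF i j = does (i ≟F j)

eqD : ∀ {b k} → Dart b k → Dart b k → Bool
eqD (web (bd i))    (web (bd i'))     = eqF i i'
eqD (web (int v j)) (web (int v' j')) = eqF v v' ∧ eqF j j'
eqD (cap i)         (cap i')          = eqF i i'
eqD (inf i)         (inf i')          = eqF i i'
eqD _               _                 = false

allDarts : ∀ b k → List (Dart b k)
allDarts b k =
  map (λ i → web (bd i)) (allFin b)
  ++ concatMap (λ v → map (λ j → web (int v j)) (allFin 3)) (allFin k)
  ++ map cap (allFin b)
  ++ map inf (allFin b)

nDarts : ℕ → ℕ → ℕ
nDarts b k = 3 * b + 3 * k

-- Rotation σ of the capped map: counterclockwise around each vertex.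
--   internal vertex v :  int v j ↦ int v (j+1 mod 3)
--   boundary vertex i :  the two darts  bd i, cap i  are swapped
--   vertex ∞          :  inf i ↦ inf (i−1 mod b)
-- (Boundary vertices are numbered 0,…,b-1 counterclockwise around the
-- boundary circle; seen from ∞, outside the disk, they appear in the
-- opposite cyclic order, hence i ↦ i−1 at ∞.)
rot : ∀ {b k} → Dart b k → Dart b k
rot (web (bd i))    = cap i
rot (web (int v j)) = web (int v (next j))
rot (cap i)         = web (bd i)
rot (inf i)         = inf (prev i)

edgeInv : ∀ {b k} → (WDart b k → WDart b k) → Dart b k → Dart b k
edgeInv mate (web x) = web (mate x)
edgeInv mate (cap i) = inf i
edgeInv mate (inf i) = cap i

-- Face permutation φ = σ ∘ α ; its orbits are the faces of the map.
facePerm : ∀ {b k} → (WDart b k → WDart b k) → Dart b k → Dart b k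
facePerm mate x = rot (edgeInv mate x)

reach : ∀ {b k} → List (Dart b k → Dart b k) → ℕ → Dart b k → Dart b k → Bool
reach fs zero    x y = eqD x y
reach fs (suc s) x y = eqD x y ∨ any (λ f → reach fs s (f x) y) fs

reachable : ∀ {b k} → List (Dart b k → Dart b k) → Dart b k → Dart b k → Bool
reachable {b} {k} fs = reach fs (nDarts b k)

-- number of orbits (the maps will be permutations, so reachability is an
-- equivalence relation); counts the darts not reachable from any earlier one
countOrbitsGo : ∀ {b k} → List (Dart b k → Dart b k) →
                List (Dart b k) → List (Dart b k) → ℕ
countOrbitsGo fs seen []       = 0
countOrbitsGo fs seen (x ∷ xs) =
  (if any (reachable fs x) seen then 0 else 1) + countOrbitsGo fs (x ∷ seen) xs

countOrbits : ∀ b k → List (Dart b k → Dart b k) → ℕ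
countOrbits b k fs = countOrbitsGo fs [] (allDarts b k)

record Web (b : ℕ) : Set where
  field
    k        : ℕ
    positive : Fin k → Bool
    mate     : WDart b k → WDart b k
    mate-invol : ∀ x → mate (mate x) ≡ x
    -- bipartite: every edge joins a negative and a positive vertex
    -- (edges are oriented negative → positive; this also excludes loops)
    bipartite  : ∀ x → sign positive x ≢ sign positive (mate x)
    simple     : ∀ x y → vertW x ≡ vertW y → vertW (mate x) ≡ vertW (mate y) → x ≡ y
  faces : ℕ
  faces = countOrbits b k (facePerm mate ∷ [])
  components : ℕ
  components = countOrbits b k (rot ∷ edgeInv mate ∷ [])
  field
    -- planarity of the embedding in the disk: the capped map is a sphere
    -- on every connected component, i.e. Euler's formula
    --   V − E + F = 2·(#components)  with  V = b + k + 1,  E = (3b + 3k)/2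
    planar : 2 * ((b + k + 1) + faces) ≡ nDarts b k + 4 * components

module _ {b : ℕ} (W : Web b) where
  open Web W

  -- a face (φ-orbit of the dart x) is internal iff it does not touch the
  -- boundary circle, i.e. contains no cap dart
  internalFace : Dart b k → Bool
  internalFace x = all (λ y → not (reachable (facePerm mate ∷ []) x y) ∨ isWeb y) (allDarts b k)

  faceSize : Dart b k → ℕ
  faceSize x = length (filterᵇ (reachable (facePerm mate ∷ []) x) (allDarts b k))

  neighborsᵇ : Fin b → Bool
  neighborsᵇ i with vertW (mate (bd i)) | vertW (mate (bd (next i)))
  ... | inj₂ v | inj₂ w = eqF v w
  ... | _      | _      = false

  neighborPairs : ℕ
  neighborPairs = length (filterᵇ neighborsᵇ (allFin b))

Irreducible : ∀ {b} → Web b → Set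
Irreducible W = ∀ x → internalFace W x ≡ true → 6 ≤ faceSize W x

-- The argument is a discharging argument on the capped map (the web plus a vertex ∞ joined to
-- every boundary vertex).  Give each face r the weight
--     w(r) = (number of darts of r) + 2 · (number of neighbour pairs i, i+1 with inf i ∈ r).
-- Every face has weight at least 6: an internal face has at least 6 darts by irreducibility,
-- and a face meeting ∞ has either at least 6 darts, or at least 4 darts and passes through a
-- dart inf i with i, i+1 neighbours (a short explicit walk along the face).  Faces partition
-- the darts and each neighbour pair lies on one face, so summing gives 6F ≤ D + 2P, where D is
-- the number of darts and P the number of neighbour pairs.  Euler's formula for the capped
-- sphere then forces P ≥ 3.
module Submission where

open import Defs
open import Data.Nat using (ℕ; zero; suc; _+_; _*_; _∸_; _≤_; _<_; z≤n; s≤s; _<?_)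
open import Data.Nat.Properties
open import Data.Nat.DivMod using (_%_; _/_; m≡m%n+[m/n]*n; m%n<n)
open import Data.Nat.GeneralisedArithmetic using (fold; fold-+)
open import Data.Nat.ListAction using (sum)
open import Data.Fin using (Fin; zero; suc; toℕ; fromℕ<; inject₁)
import Data.Fin.Properties as FinP
open import Data.Bool using (Bool; true; false; _∧_; _∨_; not; if_then_else_; T?)
open import Data.Bool.Properties using (∨-identityʳ; ∨-zeroʳ; ¬-not; T-≡)
open import Data.Bool.ListAction using (any; all)
open import Data.List using (List; []; _∷_; _++_; map; concatMap; length; filterᵇ; allFin; lookup)
open import Data.List.Properties using (length-map; length-tabulate; length-++; length-filter; map-cong)
open import Data.List.Membership.Propositional using (_∈_; lose)
import Data.List.Membership.Propositional.Properties as ∈P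
open import Data.List.Relation.Unary.Any using (index; here; there)
open import Data.List.Relation.Unary.Any.Properties using (lookup-index)
open import Data.List.Relation.Unary.All as All using (All; []; _∷_)
open import Data.List.Relation.Unary.AllPairs as AllPairs using (AllPairs; []; _∷_)
open import Data.Product using (∃; ∃₂; _×_; _,_; proj₁; proj₂)
open import Data.Sum using (inj₁; inj₂; _⊎_)
open import Data.Empty using (⊥; ⊥-elim)
open import Function.Base using (_∘_)
open import Function.Bundles using (Equivalence)
open import Relation.Nullary using (Dec; yes; no)
open import Relation.Nullary.Decidable using (dec-true)
open import Relation.Binary.PropositionalEquality
open import Algebra.Properties.CommutativeSemigroup +-commutativeSemigroup
  using () renaming (interchange to +-interchange)

false≢true : false ≢ true
false≢true ()

∧-true : ∀ {a c : Bool} → a ∧ c ≡ true → a ≡ true × c ≡ true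
∧-true {true} {true} _ = refl , refl

not-∨-false : ∀ {a c : Bool} → not a ∨ c ≡ false → a ≡ true × c ≡ false
not-∨-false {true} {false} _ = refl , refl

any-false : ∀ {X : Set} (p : X → Bool) (xs : List X) → any p xs ≡ false →
            All (λ x → p x ≡ false) xs
any-false p []       _ = []
any-false p (x ∷ xs) e with p x in px
... | false = px ∷ any-false p xs e

all-false : ∀ {X : Set} (p : X → Bool) (xs : List X) → all p xs ≡ false →
            ∃ λ x → p x ≡ false
all-false p (x ∷ xs) e with p x in px
... | false = x , px
... | true  = all-false p xs e

count : {X : Set} → (X → Bool) → List X → ℕ
count p xs = length (filterᵇ p xs)

indicator : Bool → ℕ
indicator true  = 1
indicator false = 0

indicator-false : ∀ {a : Bool} → (a ≡ true → ⊥) → indicator a ≡ 0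
indicator-false {true}  a≢true = ⊥-elim (a≢true refl)
indicator-false {false} _      = refl

count-∷ : ∀ {X : Set} (p : X → Bool) x xs → count p (x ∷ xs) ≡ indicator (p x) + count p xs
count-∷ p x xs with p x
... | true  = refl
... | false = refl

count-≤-length : ∀ {X : Set} (p : X → Bool) xs → count p xs ≤ length xs
count-≤-length p = length-filter (T? ∘ p)

∈-filterᵇ : ∀ {X : Set} (p : X → Bool) {x : X} {xs} → x ∈ xs → p x ≡ true →
            x ∈ filterᵇ p xs
∈-filterᵇ p x∈xs px = ∈P.∈-filter⁺ (T? ∘ p) x∈xs (Equivalence.from T-≡ px)

count-pos : ∀ {X : Set} (p : X → Bool) {x : X} {xs} → x ∈ xs → p x ≡ true → 0 < count p xs
count-pos p x∈xs px = nonempty (∈-filterᵇ p x∈xs px)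
  where
  nonempty : ∀ {X : Set} {x : X} {xs} → x ∈ xs → 0 < length xs
  nonempty (here  _) = s≤s z≤n
  nonempty (there _) = s≤s z≤n

module _ {X : Set} where

  sum-map-zero : (g : X → ℕ) (R : List X) → All (λ r → g r ≡ 0) R → sum (map g R) ≡ 0
  sum-map-zero g []      []         = refl
  sum-map-zero g (r ∷ R) (gr≡0 ∷ z) = cong₂ _+_ gr≡0 (sum-map-zero g R z)

  sum-map-+ : (g h : X → ℕ) (R : List X) →
              sum (map (λ r → g r + h r) R) ≡ sum (map g R) + sum (map h R)
  sum-map-+ g h []      = refl
  sum-map-+ g h (r ∷ R) =
    trans (cong (g r + h r +_) (sum-map-+ g h R)) (+-interchange (g r) (h r) _ _)

  sum-map-* : (c : ℕ) (g : X → ℕ) (R : List X) →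
              sum (map (λ r → c * g r) R) ≡ c * sum (map g R)
  sum-map-* c g []      = sym (*-zeroʳ c)
  sum-map-* c g (r ∷ R) =
    trans (cong (c * g r +_) (sum-map-* c g R)) (sym (*-distribˡ-+ c (g r) _))

  sum-map-lower : (c : ℕ) (g : X → ℕ) → (∀ r → c ≤ g r) → (R : List X) →
                  c * length R ≤ sum (map g R)
  sum-map-lower c g c≤g []      = ≤-reflexive (*-zeroʳ c)
  sum-map-lower c g c≤g (r ∷ R) = subst (_≤ g r + sum (map g R)) (sym (*-suc c (length R)))
                                        (+-mono-≤ (c≤g r) (sum-map-lower c g c≤g R))

module DoubleCounting {X D : Set} (member : X → D → Bool) (Q : D → Bool)
                      (member⇒Q : ∀ r y → member r y ≡ true → Q y ≡ true) where

  Disjoint : X → X → Set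
  Disjoint r₁ r₂ = ∀ y → member r₁ y ≡ true → member r₂ y ≡ true → ⊥

  at-most-one : ∀ y (R : List X) → AllPairs Disjoint R →
                sum (map (λ r → indicator (member r y)) R) ≤ indicator (Q y)
  at-most-one y []      _                  = z≤n
  at-most-one y (r ∷ R) (r-disjoint ∷ disj) with member r y in r∋y
  ... | false = at-most-one y R disj
  ... | true  = ≤-reflexive (begin
    1 + sum (map (λ r′ → indicator (member r′ y)) R)
      ≡⟨ cong (1 +_) (sum-map-zero _ R (All.map (λ d → indicator-false (d y r∋y)) r-disjoint)) ⟩
    1 ≡⟨ cong indicator (member⇒Q r y r∋y) ⟨
    indicator (Q y) ∎)
    where open ≡-Reasoning

  double-count : ∀ (L : List D) (R : List X) → AllPairs Disjoint R →
                 sum (map (λ r → count (member r) L) R) ≤ count Q L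
  double-count []      R _    = ≤-reflexive (sum-map-zero _ R (All.universal (λ _ → refl) R))
  double-count (y ∷ L) R disj = begin
    sum (map (λ r → count (member r) (y ∷ L)) R)
      ≡⟨ cong sum (map-cong (λ r → count-∷ (member r) y L) R) ⟩
    sum (map (λ r → indicator (member r y) + count (member r) L) R)
      ≡⟨ sum-map-+ _ _ R ⟩
    sum (map (λ r → indicator (member r y)) R) + sum (map (λ r → count (member r) L) R)
      ≤⟨ +-mono-≤ (at-most-one y R disj) (double-count L R disj) ⟩
    indicator (Q y) + count Q L
      ≡⟨ count-∷ Q y L ⟨
    count Q (y ∷ L) ∎
    where open ≤-Reasoning

repetition : ∀ {X : Set} (g : ℕ → X) (L : List X) (n : ℕ) → length L ≤ n →
             (∀ m → m ≤ n → g m ∈ L) → ∃₂ λ i j → i < j × j ≤ n × g i ≡ g j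
repetition g L n len≤n inL =
  let i , j , i<j , same-position = FinP.pigeonhole (s≤s len≤n) (index ∘ g∈L)
  in toℕ i , toℕ j , i<j , ≤-pred (FinP.toℕ<n j) ,
     trans (lookup-index (g∈L i))
           (trans (cong (lookup L) same-position) (sym (lookup-index (g∈L j))))
  where
  g∈L : (i : Fin (suc n)) → g (toℕ i) ∈ L
  g∈L i = inL (toℕ i) (≤-pred (FinP.toℕ<n i))

fold-step : ∀ {D : Set} (f : D → D) x m → fold (f x) f m ≡ fold x f (suc m)
fold-step f x zero    = refl
fold-step f x (suc m) = cong f (fold-step f x m)

module Orbits {D : Set} (f : D → D) (f-injective : ∀ {x y} → f x ≡ f y → x ≡ y)
              (A : List D) (complete : ∀ x → x ∈ A) where

  fold-cancel : ∀ m {x y} → fold x f m ≡ fold y f m → x ≡ y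
  fold-cancel zero    e = e
  fold-cancel (suc m) e = fold-cancel m (f-injective e)

  collision⇒return : ∀ {x i j} → i < j → fold x f i ≡ fold x f j → fold x f (j ∸ i) ≡ x
  collision⇒return {x} {i} {j} i<j e = sym (fold-cancel i (begin
    fold x f i                  ≡⟨ e ⟩
    fold x f j                  ≡⟨ cong (fold x f) (m+[n∸m]≡n (<⇒≤ i<j)) ⟨
    fold x f (i + (j ∸ i))      ≡⟨ fold-+ x f i ⟩
    fold (fold x f (j ∸ i)) f i ∎))
    where open ≡-Reasoning

  period : ∀ x → ∃ λ p → 0 < p × p ≤ length A × fold x f p ≡ x
  period x with repetition (fold x f) A (length A) ≤-refl (λ m _ → complete (fold x f m))
  ... | i , j , i<j , j≤ , e =
    j ∸ i , m<n⇒0<n∸m i<j , ≤-trans (m∸n≤m j i) j≤ , collision⇒return i<j e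

  fold-multiple : ∀ {x p} → fold x f p ≡ x → ∀ t → fold x f (t * p) ≡ x
  fold-multiple         per zero    = refl
  fold-multiple {x} {p} per (suc t) =
    trans (fold-+ x f p) (trans (cong (λ z → fold z f p) (fold-multiple per t)) per)

  Reaches : D → D → Set
  Reaches x y = ∃ λ m → fold x f m ≡ y

  reaches-trans : ∀ {x y z} → Reaches x y → Reaches y z → Reaches x z
  reaches-trans {x} (a , refl) (c , refl) = c + a , fold-+ x f c

  -- going once more around the orbit of x leads from fᵐ(x) back to x
  reaches-sym : ∀ {x y} → Reaches x y → Reaches y x
  reaches-sym {x} (m , refl) with period x
  ... | suc q , _ , _ , per = m * q , (begin
    fold (fold x f m) f (m * q) ≡⟨ fold-+ x f (m * q) ⟨
    fold x f (m * q + m)        ≡⟨ cong (fold x f) (trans (+-comm (m * q) m) (sym (*-suc m q))) ⟩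
    fold x f (m * suc q)        ≡⟨ fold-multiple per m ⟩
    x ∎)
    where open ≡-Reasoning

  reaches-shorten : ∀ {x y} → Reaches x y → ∃ λ m → m < length A × fold x f m ≡ y
  reaches-shorten {x} (m , refl) with period x
  ... | suc q , _ , p≤ , per = r , <-≤-trans (m%n<n m (suc q)) p≤ , (begin
    fold x f r                      ≡⟨ cong (λ z → fold z f r) (fold-multiple per t) ⟨
    fold (fold x f (t * suc q)) f r ≡⟨ fold-+ x f r ⟨
    fold x f (r + t * suc q)        ≡⟨ cong (fold x f) (m≡m%n+[m/n]*n m (suc q)) ⟨
    fold x f m                      ∎)
    where
    open ≡-Reasoning
    r t : ℕ
    r = m % suc q
    t = m / suc q

  record NoReturn (x : D) (M : ℕ) : Set where
    constructor noReturn
    field never-returns : ∀ d → 0 < d → d ≤ M → fold x f d ≢ x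

  noReturn-zero : ∀ {x} → NoReturn x 0
  noReturn-zero = noReturn λ { (suc d) _ () }

  infixl 5 _▸_
  _▸_ : ∀ {x M} → NoReturn x M → fold x f (suc M) ≢ x → NoReturn x (suc M)
  _▸_ {x} {M} (noReturn nr) step = noReturn never
    where
    never : ∀ d → 0 < d → d ≤ suc M → fold x f d ≢ x
    never d 0<d d≤1+M with m≤n⇒m<n∨m≡n d≤1+M
    ... | inj₁ d<1+M = nr d 0<d (≤-pred d<1+M)
    ... | inj₂ refl  = step

  orbit-size : ∀ {x M} (L : List D) → NoReturn x M → (∀ m → m ≤ M → fold x f m ∈ L) →
               M < length L
  orbit-size {x} {M} L (noReturn nr) inL = ≰⇒> λ len≤M →
    let i , j , i<j , j≤M , e = repetition (fold x f) L M len≤M inL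
    in nr (j ∸ i) (m<n⇒0<n∸m i<j) (≤-trans (m∸n≤m j i) j≤M) (collision⇒return i<j e)

eqF-refl : ∀ {m} (i : Fin m) → eqF i i ≡ true
eqF-refl i = dec-true (i FinP.≟ i) refl

eqF-sound : ∀ {m} {i j : Fin m} → eqF i j ≡ true → i ≡ j
eqF-sound {i = i} {j} e with i FinP.≟ j
... | yes i≡j = i≡j
eqF-sound {i = i} {j} () | no _

eqD-refl : ∀ {b k} (x : Dart b k) → eqD x x ≡ true
eqD-refl (web (bd i))    = eqF-refl i
eqD-refl (web (int v j)) = cong₂ _∧_ (eqF-refl v) (eqF-refl j)
eqD-refl (cap i)         = eqF-refl i
eqD-refl (inf i)         = eqF-refl i

eqD-sound : ∀ {b k} {x y : Dart b k} → eqD x y ≡ true → x ≡ y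
eqD-sound {x = web (bd i)}    {web (bd i′)}     e = cong (web ∘ bd) (eqF-sound e)
eqD-sound {x = web (int v j)} {web (int v′ j′)} e =
  let v≡v′ , j≡j′ = ∧-true {eqF v v′} e
  in cong₂ (λ u l → web (int u l)) (eqF-sound v≡v′) (eqF-sound j≡j′)
eqD-sound {x = cap i}         {cap i′}          e = cong cap (eqF-sound e)
eqD-sound {x = inf i}         {inf i′}          e = cong inf (eqF-sound e)
eqD-sound {x = web (bd _)}    {web (int _ _)}   ()
eqD-sound {x = web (bd _)}    {cap _}           ()
eqD-sound {x = web (bd _)}    {inf _}           ()
eqD-sound {x = web (int _ _)} {web (bd _)}      ()
eqD-sound {x = web (int _ _)} {cap _}           ()
eqD-sound {x = web (int _ _)} {inf _}           ()
eqD-sound {x = cap _}         {web _}           ()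
eqD-sound {x = cap _}         {inf _}           ()
eqD-sound {x = inf _}         {web _}           ()
eqD-sound {x = inf _}         {cap _}           ()

next-prev : ∀ {m} (i : Fin m) → next (prev i) ≡ i
next-prev {suc m} zero    = next-last (fromℕ< (n<1+n m)) (FinP.toℕ-fromℕ< (n<1+n m))
  where
  next-last : (i : Fin (suc m)) → toℕ i ≡ m → next i ≡ zero
  next-last i i≡m with suc (toℕ i) <? suc m
  ... | yes i<m = ⊥-elim (<-irrefl (cong suc i≡m) i<m)
  ... | no _    = refl
next-prev {suc m} (suc i) = FinP.toℕ-injective (begin
  toℕ (next (inject₁ i)) ≡⟨ next-inner (inject₁ i) inner ⟩
  suc (toℕ (inject₁ i))  ≡⟨ cong suc (FinP.toℕ-inject₁ i) ⟩
  suc (toℕ i)            ∎)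
  where
  open ≡-Reasoning
  inner : suc (toℕ (inject₁ i)) < suc m
  inner = s≤s (subst (_< m) (sym (FinP.toℕ-inject₁ i)) (FinP.toℕ<n i))
  next-inner : (l : Fin (suc m)) → suc (toℕ l) < suc m → toℕ (next l) ≡ suc (toℕ l)
  next-inner l l<m with suc (toℕ l) <? suc m
  ... | yes l<m′ = FinP.toℕ-fromℕ< l<m′
  ... | no l≮m  = ⊥-elim (l≮m l<m)

prev-next₃ : (j : Fin 3) → prev (next j) ≡ j
prev-next₃ zero             = refl
prev-next₃ (suc zero)       = refl
prev-next₃ (suc (suc zero)) = refl

unrot : ∀ {b k} → Dart b k → Dart b k
unrot (web (bd i))    = cap i
unrot (web (int v j)) = web (int v (prev j))
unrot (cap i)         = web (bd i)
unrot (inf i)         = inf (next i)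

unrot-rot : ∀ {b k} (x : Dart b k) → unrot (rot x) ≡ x
unrot-rot (web (bd i))    = refl
unrot-rot (web (int v j)) = cong (web ∘ int v) (prev-next₃ j)
unrot-rot (cap i)         = refl
unrot-rot (inf i)         = cong inf (next-prev i)

rot-injective : ∀ {b k} {x y : Dart b k} → rot x ≡ rot y → x ≡ y
rot-injective {x = x} {y} e = trans (sym (unrot-rot x)) (trans (cong unrot e) (unrot-rot y))

boundaryDarts internalDarts capDarts infDarts : ∀ b k → List (Dart b k)
boundaryDarts b k = map (web ∘ bd) (allFin b)
internalDarts b k = concatMap (λ v → map (web ∘ int v) (allFin 3)) (allFin k)
capDarts      b k = map cap (allFin b)
infDarts      b k = map inf (allFin b)

allDarts-complete : ∀ {b k} (x : Dart b k) → x ∈ allDarts b k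
allDarts-complete (web (bd i)) = ∈P.∈-++⁺ˡ (∈P.∈-map⁺ (web ∘ bd) (∈P.∈-allFin i))
allDarts-complete {b} {k} (web (int v j)) =
  ∈P.∈-++⁺ʳ (boundaryDarts b k) (∈P.∈-++⁺ˡ (∈P.∈-concatMap⁺ (λ u → map (web ∘ int u) (allFin 3))
    (lose (∈P.∈-allFin v) (∈P.∈-map⁺ (web ∘ int v) (∈P.∈-allFin j)))))
allDarts-complete {b} {k} (cap i) =
  ∈P.∈-++⁺ʳ (boundaryDarts b k) (∈P.∈-++⁺ʳ (internalDarts b k)
    (∈P.∈-++⁺ˡ (∈P.∈-map⁺ cap (∈P.∈-allFin i))))
allDarts-complete {b} {k} (inf i) =
  ∈P.∈-++⁺ʳ (boundaryDarts b k) (∈P.∈-++⁺ʳ (internalDarts b k)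
    (∈P.∈-++⁺ʳ (capDarts b k) (∈P.∈-map⁺ inf (∈P.∈-allFin i))))

allDarts-length : ∀ b k → length (allDarts b k) ≡ nDarts b k
allDarts-length b k = begin
  length (boundary ++ internal ++ caps ++ infs)
    ≡⟨ length-++ boundary ⟩
  length boundary + length (internal ++ caps ++ infs)
    ≡⟨ cong (length boundary +_) (length-++ internal) ⟩
  length boundary + (length internal + length (caps ++ infs))
    ≡⟨ cong (λ n → length boundary + (length internal + n)) (length-++ caps) ⟩
  length boundary + (length internal + (length caps + length infs))
    ≡⟨ cong₂ (λ x y → x + (y + (length caps + length infs)))
             (length-mapFin b) (internal-length (allFin k)) ⟩
  b + (3 * length (allFin k) + (length caps + length infs))
    ≡⟨ cong₂ (λ x y → b + (3 * x + y))
             (length-tabulate {n = k} (λ v → v)) (cong₂ _+_ (length-mapFin b) (length-mapFin b)) ⟩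
  b + (3 * k + (b + b))
    ≡⟨ rearrange b k ⟩
  3 * b + 3 * k ∎
  where
  open ≡-Reasoning
  boundary = boundaryDarts b k
  internal = internalDarts b k
  caps     = capDarts b k
  infs     = infDarts b k
  length-mapFin : ∀ {Y : Set} n {f : Fin n → Y} → length (map f (allFin n)) ≡ n
  length-mapFin n {f} = trans (length-map f (allFin n)) (length-tabulate (λ i → i))
  internal-length : (vs : List (Fin k)) →
                    length (concatMap (λ v → map (web {b} ∘ int v) (allFin 3)) vs) ≡ 3 * length vs
  internal-length []       = refl
  internal-length (v ∷ vs) =
    trans (cong (3 +_) (internal-length vs)) (sym (*-suc 3 (length vs)))
  rearrange : ∀ b k → b + (3 * k + (b + b)) ≡ 3 * b + 3 * k
  rearrange = solve-∀
    where open import Data.Nat.Tactic.RingSolver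

representatives : ∀ {D : Set} → (D → D → Bool) → List D → List D → List D
representatives rel seen []       = []
representatives rel seen (x ∷ xs) =
  if any (rel x) seen then representatives rel (x ∷ seen) xs
                      else x ∷ representatives rel (x ∷ seen) xs

countOrbitsGo-representatives : ∀ {b k} (fs : List (Dart b k → Dart b k)) seen xs →
  countOrbitsGo fs seen xs ≡ length (representatives (reachable fs) seen xs)
countOrbitsGo-representatives fs seen []       = refl
countOrbitsGo-representatives fs seen (x ∷ xs) with any (reachable fs x) seen
... | true  = countOrbitsGo-representatives fs (x ∷ seen) xs
... | false = cong suc (countOrbitsGo-representatives fs (x ∷ seen) xs)

module _ {D : Set} (rel : D → D → Bool) where

  representatives-fresh : ∀ seen xs →
    All (λ r → All (λ s → rel r s ≡ false) seen) (representatives rel seen xs)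
  representatives-fresh seen []       = []
  representatives-fresh seen (x ∷ xs) with any (rel x) seen in seen?
  ... | true  = All.map All.tail (representatives-fresh (x ∷ seen) xs)
  ... | false = any-false (rel x) seen seen? ∷ All.map All.tail (representatives-fresh (x ∷ seen) xs)

  representatives-apart : ∀ seen xs →
    AllPairs (λ r₁ r₂ → rel r₂ r₁ ≡ false) (representatives rel seen xs)
  representatives-apart seen []       = []
  representatives-apart seen (x ∷ xs) with any (rel x) seen
  ... | true  = representatives-apart (x ∷ seen) xs
  ... | false = All.map All.head (representatives-fresh (x ∷ seen) xs)
              ∷ representatives-apart (x ∷ seen) xs

≢-via : ∀ {X : Set} {a b c : X} → a ≡ b → b ≢ c → a ≢ c
≢-via refl b≢c = b≢c

module Faces {b : ℕ} (W : Web b) where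
  open Web W

  φ : Dart b k → Dart b k
  φ = facePerm mate

  edgeInv-involutive : ∀ x → edgeInv mate (edgeInv mate x) ≡ x
  edgeInv-involutive (web x) = cong web (mate-invol x)
  edgeInv-involutive (cap i) = refl
  edgeInv-involutive (inf i) = refl

  φ-injective : ∀ {x y} → φ x ≡ φ y → x ≡ y
  φ-injective {x} {y} e = trans (sym (edgeInv-involutive x))
                                (trans (cong (edgeInv mate) (rot-injective e)) (edgeInv-involutive y))

  open Orbits φ φ-injective (allDarts b k) allDarts-complete

  sameFace : Dart b k → Dart b k → Bool
  sameFace = reachable (φ ∷ [])

  reach-sound : ∀ s x y → reach (φ ∷ []) s x y ≡ true → Reaches x y
  reach-sound zero    x y e = 0 , eqD-sound e
  reach-sound (suc s) x y e with eqD x y in x≡y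
  ... | true  = 0 , eqD-sound x≡y
  ... | false with reach-sound s (φ x) y (trans (sym (∨-identityʳ _)) e)
  ...   | m , e′ = suc m , trans (sym (fold-step φ x m)) e′

  reach-complete : ∀ s m {x y} → m ≤ s → fold x φ m ≡ y → reach (φ ∷ []) s x y ≡ true
  reach-complete zero    zero    {x} z≤n refl = eqD-refl x
  reach-complete (suc s) zero    {x} z≤n refl rewrite eqD-refl x = refl
  reach-complete (suc s) (suc m) {x} {y} (s≤s m≤s) e
    rewrite reach-complete s m m≤s (trans (fold-step φ x m) e) = ∨-zeroʳ (eqD x y)

  sameFace-sound : ∀ {x y} → sameFace x y ≡ true → Reaches x y
  sameFace-sound {x} {y} = reach-sound (nDarts b k) x y

  sameFace-complete : ∀ {x y} → Reaches x y → sameFace x y ≡ true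
  sameFace-complete x→y with reaches-shorten x→y
  ... | m , m<len , e =
    reach-complete (nDarts b k) m (≤-trans (<⇒≤ m<len) (≤-reflexive (allDarts-length b k))) e

  sameFace-sym : ∀ {x y} → sameFace x y ≡ true → sameFace y x ≡ true
  sameFace-sym = sameFace-complete ∘ reaches-sym ∘ sameFace-sound

  sameFace-trans : ∀ {x y z} → sameFace x y ≡ true → sameFace y z ≡ true →
                   sameFace x z ≡ true
  sameFace-trans x~y y~z = sameFace-complete (reaches-trans (sameFace-sound x~y) (sameFace-sound y~z))

  face-size : ∀ {r x M} → sameFace r x ≡ true → NoReturn x M →
              M < count (sameFace r) (allDarts b k)
  face-size {r} {x} r~x no-return =
    orbit-size (filterᵇ (sameFace r) (allDarts b k)) no-return λ m _ →
      ∈-filterᵇ (sameFace r) (allDarts-complete _) (sameFace-trans r~x (sameFace-complete (m , refl)))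

  sign-mate : ∀ {x y} → mate x ≡ y → sign positive y ≡ not (sign positive x)
  sign-mate {x} refl = ¬-not (bipartite x ∘ sym)

  mate-flip : ∀ {x y} → mate x ≡ y → mate y ≡ x
  mate-flip {x} refl = mate-invol x

  rot-web≢inf : ∀ (z : WDart b k) i → rot (web z) ≢ inf i
  rot-web≢inf (bd _)    i ()
  rot-web≢inf (int _ _) i ()

  after-web : ∀ {x y i} d → fold x φ d ≡ web y → fold x φ (suc d) ≢ inf i
  after-web {y = y} {i} d e = ≢-via (cong φ e) (rot-web≢inf (mate y) i)

  neighbours-via : ∀ {i v j j′} → mate (bd i) ≡ int v j → mate (bd (next i)) ≡ int v j′ →
                   neighborsᵇ W i ≡ true
  neighbours-via {i} {v} e₁ e₂
    with vertW (mate (bd i)) | vertW (mate (bd (next i))) | cong vertW e₁ | cong vertW e₂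
  ... | _ | _ | refl | refl = eqF-refl v

  -- The face through the dart inf i: its walk starts  inf i, bd i, v, …  where v is the
  -- internal vertex attached to i.
  FaceAtInf : Fin b → Set
  FaceAtInf i = NoReturn (inf i) 5 ⊎ (NoReturn (inf i) 3 × neighborsᵇ W i ≡ true)

  walk-start : ∀ {i v j} → mate (bd i) ≡ int v j →
               NoReturn (inf i) 2 × fold (inf i) φ 2 ≡ web (int v (next j))
  walk-start {i} m₁ = noReturn-zero ▸ (λ ()) ▸ after-web {inf i} 1 refl , cong (rot ∘ web) m₁

  -- the walk returns to the boundary at i′, then passes through ∞ to inf (i′ − 1)
  walk-to-boundary : ∀ {i v j i′} → mate (bd i) ≡ int v j → mate (int v (next j)) ≡ bd i′ →
                     FaceAtInf i
  walk-to-boundary {i} {v} {j} {i′} m₁ m₂ = decide (prev i′ FinP.≟ i)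
    where
    at-cap : fold (inf i) φ 3 ≡ cap i′
    at-cap = trans (cong φ (proj₂ (walk-start m₁))) (cong (rot ∘ web) m₂)
    no-return₃ : NoReturn (inf i) 3
    no-return₃ = proj₁ (walk-start m₁) ▸ ≢-via at-cap (λ ())
    decide : Dec (prev i′ ≡ i) → FaceAtInf i
    decide (yes i′-1≡i) = inj₂ (no-return₃ , neighbours-via m₁ (begin
      mate (bd (next i))        ≡⟨ cong (λ l → mate (bd (next l))) i′-1≡i ⟨
      mate (bd (next (prev i′))) ≡⟨ cong (mate ∘ bd) (next-prev i′) ⟩
      mate (bd i′)              ≡⟨ mate-flip m₂ ⟩
      int v (next j)            ∎))
      where open ≡-Reasoning
    decide (no i′-1≢i) = inj₁ (no-return₃
      ▸ ≢-via (cong φ at-cap) (λ { refl → i′-1≢i refl })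
      ▸ ≢-via (cong (φ ∘ φ) at-cap) (λ ()))

  -- the walk continues to a negative internal vertex w, whose next neighbour is internal too
  walk-inside : ∀ {i v j w l} → mate (bd i) ≡ int v j → mate (int v (next j)) ≡ int w l →
                FaceAtInf i
  walk-inside {i} {v} {j} {w} {l} m₁ m₂ = third-step (mate (int w (next l))) refl
    where
    at-v : fold (inf i) φ 2 ≡ web (int v (next j))
    at-v = proj₂ (walk-start m₁)
    at-w : fold (inf i) φ 3 ≡ web (int w (next l))
    at-w = trans (cong φ at-v) (cong (rot ∘ web) m₂)
    -- signs alternate along  bd i (negative), v, w: so w is negative and has no boundary neighbour
    third-step : ∀ y → mate (int w (next l)) ≡ y → FaceAtInf i
    third-step (bd _)    m₃ = ⊥-elim (false≢true
      (trans (sign-mate m₃) (cong not (trans (sign-mate m₂) (cong not (sign-mate m₁))))))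
    third-step (int u m) m₃ =
      inj₁ (proj₁ (walk-start m₁) ▸ after-web {inf i} 2 at-v ▸ after-web {inf i} 3 at-w
                                  ▸ after-web {inf i} 4 at-u)
      where
      at-u : fold (inf i) φ 4 ≡ web (int u (next m))
      at-u = trans (cong φ at-w) (cong (rot ∘ web) m₃)

  -- the first two edges of the walk decide between the two cases above; a boundary vertex is
  -- never joined to another boundary vertex
  face-at-inf : ∀ i → FaceAtInf i
  face-at-inf i = first-step (mate (bd i)) refl
    where
    first-step : ∀ y → mate (bd i) ≡ y → FaceAtInf i
    first-step (bd _)    m₁ = ⊥-elim (false≢true (sign-mate m₁))
    first-step (int v j) m₁ = second-step (mate (int v (next j))) refl
      where
      second-step : ∀ z → mate (int v (next j)) ≡ z → FaceAtInf i
      second-step (bd _)    m₂ = walk-to-boundary m₁ m₂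
      second-step (int _ _) m₂ = walk-inside m₁ m₂

  neighboursOn : Dart b k → Fin b → Bool
  neighboursOn r i = sameFace r (inf i) ∧ neighborsᵇ W i

  weight : Dart b k → ℕ
  weight r = count (sameFace r) (allDarts b k) + 2 * count (neighboursOn r) (allFin b)

  weight-at-inf : ∀ r i → sameFace r (inf i) ≡ true → 6 ≤ weight r
  weight-at-inf r i r~inf with face-at-inf i
  ... | inj₁ no-return₅             = ≤-trans (face-size r~inf no-return₅) (m≤m+n _ _)
  ... | inj₂ (no-return₃ , i-i+1) =
    +-mono-≤ (face-size r~inf no-return₃)
             (*-monoʳ-≤ 2 (count-pos (neighboursOn r) (∈P.∈-allFin i) (cong₂ _∧_ r~inf i-i+1)))

  -- every face has weight at least 6: internal faces by irreducibility, the others because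
  -- they pass through ∞
  weight-≥6 : Irreducible W → ∀ r → 6 ≤ weight r
  weight-≥6 irr r with internalFace W r in internal
  ... | true  = ≤-trans (irr r internal) (m≤m+n _ _)
  ... | false with all-false _ (allDarts b k) internal
  ...   | y , y-outside with not-∨-false {sameFace r y} y-outside
  ...     | r~y , y-not-web = outer y r~y y-not-web
    where
    outer : ∀ y → sameFace r y ≡ true → isWeb y ≡ false → 6 ≤ weight r
    outer (cap i) r~cap _ =
      weight-at-inf r (prev i) (sameFace-trans r~cap (sameFace-complete (1 , refl)))
    outer (inf i) r~inf _ = weight-at-inf r i r~inf

  faces-bound : Irreducible W → 6 * faces ≤ nDarts b k + 2 * neighborPairs W
  faces-bound irr = begin
    6 * faces
      ≡⟨ cong (6 *_) (countOrbitsGo-representatives (φ ∷ []) [] (allDarts b k)) ⟩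
    6 * length R
      ≤⟨ sum-map-lower 6 weight (weight-≥6 irr) R ⟩
    sum (map weight R)
      ≡⟨ sum-map-+ size (λ r → 2 * neighbourCount r) R ⟩
    sum (map size R) + sum (map (λ r → 2 * neighbourCount r) R)
      ≡⟨ cong (sum (map size R) +_) (sum-map-* 2 neighbourCount R) ⟩
    sum (map size R) + 2 * sum (map neighbourCount R)
      ≤⟨ +-mono-≤ (FaceDarts.double-count (allDarts b k) R darts-disjoint)
                  (*-monoʳ-≤ 2 (FaceNeighbours.double-count (allFin b) R neighbours-disjoint)) ⟩
    count (λ _ → true) (allDarts b k) + 2 * neighborPairs W
      ≤⟨ +-monoˡ-≤ _ (count-≤-length _ (allDarts b k)) ⟩
    length (allDarts b k) + 2 * neighborPairs W
      ≡⟨ cong (_+ 2 * neighborPairs W) (allDarts-length b k) ⟩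
    nDarts b k + 2 * neighborPairs W ∎
    where
    open ≤-Reasoning
    R = representatives sameFace [] (allDarts b k)
    size neighbourCount : Dart b k → ℕ
    size r           = count (sameFace r) (allDarts b k)
    neighbourCount r = count (neighboursOn r) (allFin b)
    module FaceDarts      = DoubleCounting sameFace (λ _ → true) (λ _ _ _ → refl)
    module FaceNeighbours = DoubleCounting neighboursOn (neighborsᵇ W)
                                           (λ r i on → proj₂ (∧-true {sameFace r (inf i)} on))
    apart⇒disjoint : ∀ {r₁ r₂ y} → sameFace r₂ r₁ ≡ false →
                     sameFace r₁ y ≡ true → sameFace r₂ y ≡ true → ⊥
    apart⇒disjoint r₂≁r₁ r₁~y r₂~y =
      false≢true (trans (sym r₂≁r₁) (sameFace-trans r₂~y (sameFace-sym r₁~y)))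
    apart : AllPairs (λ r₁ r₂ → sameFace r₂ r₁ ≡ false) R
    apart = representatives-apart sameFace [] (allDarts b k)
    darts-disjoint : AllPairs FaceDarts.Disjoint R
    darts-disjoint = AllPairs.map (λ r₂≁r₁ y → apart⇒disjoint r₂≁r₁) apart
    neighbours-disjoint : AllPairs FaceNeighbours.Disjoint R
    neighbours-disjoint = AllPairs.map (λ {r₁} {r₂} r₂≁r₁ i on₁ on₂ →
      apart⇒disjoint r₂≁r₁ (proj₁ (∧-true {sameFace r₁ (inf i)} on₁))
                           (proj₁ (∧-true {sameFace r₂ (inf i)} on₂))) apart

-- Euler's formula  2(V + F) = 2E + 4C  with V = b + k + 1, 2E = 3b + 3k and C ≥ 1 components,
-- together with 6F ≤ 2E + 2P, forces P ≥ 3.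
euler-bound : ∀ b k F C P → 2 * ((b + k + 1) + F) ≡ 3 * b + 3 * k + 4 * C → 1 ≤ C →
              6 * F ≤ 3 * b + 3 * k + 2 * P → 3 ≤ P
euler-bound b k F C P euler 1≤C faces≤ = *-cancelˡ-≤ 2 (+-cancelˡ-≤ (3 * E + 6) _ _ (begin
  3 * E + 6 + 6                    ≡⟨ +-assoc (3 * E) 6 6 ⟩
  3 * E + 12                       ≤⟨ +-monoʳ-≤ (3 * E) (*-monoʳ-≤ 12 1≤C) ⟩
  3 * E + 12 * C                   ≡⟨ three-times E C ⟨
  3 * (E + 4 * C)                  ≡⟨ cong (3 *_) euler ⟨
  3 * (2 * ((b + k + 1) + F))      ≡⟨ expand b k F ⟩
  2 * E + 6 + 6 * F                ≤⟨ +-monoʳ-≤ (2 * E + 6) faces≤ ⟩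
  2 * E + 6 + (E + 2 * P)          ≡⟨ collect E P ⟩
  3 * E + 6 + 2 * P                ∎))
  where
  open ≤-Reasoning
  open import Data.Nat.Tactic.RingSolver
  E = 3 * b + 3 * k
  three-times : ∀ E C → 3 * (E + 4 * C) ≡ 3 * E + 12 * C
  three-times = solve-∀
  expand : ∀ b k F → 3 * (2 * ((b + k + 1) + F)) ≡ 2 * (3 * b + 3 * k) + 6 + 6 * F
  expand = solve-∀
  collect : ∀ E P → 2 * E + 6 + (E + 2 * P) ≡ 3 * E + 6 + 2 * P
  collect = solve-∀

neighbourPairs-≥3 : ∀ {b} (W : Web (suc b)) → Irreducible W → 3 ≤ neighborPairs W
neighbourPairs-≥3 {b} W irr =
  euler-bound (suc b) k faces components (neighborPairs W)
              planar at-least-one-component (Faces.faces-bound W irr)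
  where
  open Web W
  -- with b ≥ 1 the first dart is a boundary dart, and countOrbits always counts the first dart
  at-least-one-component : 1 ≤ components
  at-least-one-component = s≤s z≤n

lemma3p1 : (n : ℕ) → 1 ≤ n → (W : Web (3 * n)) → Irreducible W →
    3 ≤ neighborPairs W
lemma3p1 zero    ()
lemma3p1 (suc n) _  W irr = neighbourPairs-≥3 W irr
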